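{- For every integer $k\ge 0$, $$\sum_{n\ge 0}a(n,2k+1,t)\,x^n=\frac{\Phi_k(x,t)-x^2\Phi_{k-1}(x,t)}{\Phi_{k+1}(x,t)-x(x+1)\Phi_k(x,t)+x^3\Phi_{k-1}(x,t)}$$ as formal power series in $x$ (with coefficients polynomials in $t$).
   Context: Up-step $U:(i,j)\to(i+1,j+1)$, down-step $D:(i,j)\to(i+1,j-1)$. For integers $n,k\ge 0$, $A_{n,k}$ is the set of lattice paths of length $n$ consisting of $U$ and $D$ steps that start at $(0,0)$, end at height $0$ or $-1$, and stay in the strip $-\lfloor (k+1)/2\rfloor\le y\le \lfloor k/2\rfloor$. A peak of a path is a vertex preceded by a $U$ and followed by a $D$; a valley is a vertex preceded by a $D$ and followed by a $U$; the height of a vertex is its $y$-coordinate. The extremal points of a path $v$ are its peaks of height $\ge 1$ and its valleys of height $\le -2$; $e(v)$ is their number. Define $a(n,k,t)=\sum_{v\in A_{n,k}}t^{e(v)}$. Fibonacci polynomials: $F_0(x,s)=0$, $F_1(x,s)=1$, $F_n(x,s)=xF_{n-1}(x,s)+sF_{n-2}(x,s)$, so $F_n(x,s)=\sum_{j=0}^{\lfloor (n-1)/2\rfloor}\binom{n-1-j}{j}x^{n-1-2j}s^j$ for $n\ge1$; extending the recurrence backwards gives $F_{ -1}(x,s)=1/s$. Set $\Phi_n(x,t)=F_n(1+(1-t)x^2,-x^2)$; in particular $\Phi_0=0$, $\Phi_1=1$ and $\Phi_{ -1}(x,t)=-1/x^2$. -}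

module Defs where

open import Data.Bool using (Bool; true; false; _∧_; if_then_else_)
open import Data.Nat as ℕ using (ℕ; zero; suc; _∸_)
open import Data.Nat.DivMod using (_/_)
open import Data.Integer as ℤ using (ℤ; +_; -_; _≤ᵇ_)
open import Data.List using (List; []; _∷_; map; _++_; length; filterᵇ)
open import Data.Vec using (Vec; []; _∷_)

-- Lattice paths: a path of length n is a word in {U,D}^n,
-- encoded as  Vec Bool n  with  true = U (up-step), false = D (down-step).

Path : ℕ → Set
Path n = Vec Bool n

allPaths : (n : ℕ) → List (Path n)
allPaths zero    = [] ∷ []
allPaths (suc n) = map (true ∷_) (allPaths n) ++ map (false ∷_) (allPaths n)

step : Bool → ℤ → ℤ
step true  h = h ℤ.+ + 1
step false h = h ℤ.- + 1

inRange : ℤ → ℤ → ℤ → Bool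
inRange lo hi h = (lo ≤ᵇ h) ∧ (h ≤ᵇ hi)

staysIn : ∀ {n} → ℤ → ℤ → ℤ → Path n → Bool
staysIn lo hi h []       = inRange lo hi h
staysIn lo hi h (b ∷ bs) = inRange lo hi h ∧ staysIn lo hi (step b h) bs

endHeight : ∀ {n} → ℤ → Path n → ℤ
endHeight h []       = h
endHeight h (b ∷ bs) = endHeight (step b h) bs

isZeroOrMinusOne : ℤ → Bool
isZeroOrMinusOne h = inRange (- + 1) (+ 0) h

lowBound : ℕ → ℤ
lowBound k = - (+ (suc k / 2))

highBound : ℕ → ℤ
highBound k = + (k / 2)

inA : ∀ {n} → ℕ → Path n → Bool
inA k v = staysIn (lowBound k) (highBound k) (+ 0) v ∧ isZeroOrMinusOne (endHeight (+ 0) v)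

-- e(v): number of extremal points = peaks (U then D) at height ≥ 1
-- plus valleys (D then U) at height ≤ -2.  `ext h v` counts them for
-- the path v started at height h (the vertex between the first two
-- steps has height  step b₁ h).
ext : ∀ {n} → ℤ → Path n → ℕ
ext h []                = 0
ext h (b ∷ [])          = 0
ext h (true  ∷ true  ∷ bs) = ext (step true h) (true ∷ bs)
ext h (false ∷ false ∷ bs) = ext (step false h) (false ∷ bs)
ext h (true  ∷ false ∷ bs) =
  (if (+ 1) ≤ᵇ step true h then 1 else 0) ℕ.+ ext (step true h) (false ∷ bs)
ext h (false ∷ true  ∷ bs) =
  (if step false h ≤ᵇ - (+ 2) then 1 else 0) ℕ.+ ext (step false h) (true ∷ bs)

e : ∀ {n} → Path n → ℕ
e v = ext (+ 0) v

-- coefficient of t^j in a(n,k,t) = #{ v ∈ A_{n,k} : e(v) = j }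
aCoeff : ℕ → ℕ → ℕ → ℕ
aCoeff n k j = length (filterᵇ (λ v → inA k v ∧ (e v ℕ.≡ᵇ j)) (allPaths n))

-- Formal power series in x and t with integer coefficients:
-- s i j = coefficient of x^i t^j.  (ℤ[t][[x]] embeds in ℤ[[x,t]].)

Ser : Set
Ser = ℕ → ℕ → ℤ

sumTo : ℕ → (ℕ → ℤ) → ℤ
sumTo zero    f = f 0
sumTo (suc n) f = sumTo n f ℤ.+ f (suc n)

_⊕_ : Ser → Ser → Ser
(f ⊕ g) i j = f i j ℤ.+ g i j

⊝_ : Ser → Ser
(⊝ f) i j = ℤ.- f i j

_⊖_ : Ser → Ser → Ser
f ⊖ g = f ⊕ (⊝ g)

_⊛_ : Ser → Ser → Ser
(f ⊛ g) i j = sumTo i (λ a → sumTo j (λ b → f a b ℤ.* g (i ∸ a) (j ∸ b)))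

infixl 6 _⊕_ _⊖_
infixl 7 _⊛_
infix 8 ⊝_

mono : ℕ → ℕ → Ser
mono p q i j = if (i ℕ.≡ᵇ p) ∧ (j ℕ.≡ᵇ q) then + 1 else + 0

𝟘 𝟙 X T : Ser
𝟘 i j = + 0
𝟙 = mono 0 0
X = mono 1 0
T = mono 0 1

Fib : {A : Set} → A → A → (A → A → A) → (A → A → A) → A → A → ℕ → A
Fib zr on add mul x s zero          = zr
Fib zr on add mul x s (suc zero)    = on
Fib zr on add mul x s (suc (suc n)) =
  add (mul x (Fib zr on add mul x s (suc n))) (mul s (Fib zr on add mul x s n))

Φ : ℕ → Ser
Φ = Fib 𝟘 𝟙 _⊕_ _⊛_ (𝟙 ⊕ (𝟙 ⊖ T) ⊛ X ⊛ X) (⊝ (X ⊛ X))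

-- x² Φ_{k-1}(x,t) for k ≥ 0, using Φ_{-1} = -1/x²  (so x²Φ_{-1} = -1)
x²Φpred : ℕ → Ser
x²Φpred zero    = ⊝ 𝟙
x²Φpred (suc k) = X ⊛ X ⊛ Φ k

Num : ℕ → Ser
Num k = Φ k ⊖ x²Φpred k

Den : ℕ → Ser
Den k = Φ (suc k) ⊖ X ⊛ (X ⊕ 𝟙) ⊛ Φ k ⊕ X ⊛ x²Φpred k

GF : ℕ → Ser
GF k n j = + aCoeff n (suc (2 ℕ.* k)) j

-- Decompose paths by their first step. In the strip −(k+1) ≤ y ≤ k, the generating
-- functions F h d of paths from height h whose previous step was d form the unique solution
-- of a finite linear system: F h d is 1 at the end heights 0, −1 (for the empty path) plus
-- x F (h ± 1), with an extra factor t when the step leaves a peak of height ≥ 1 or a valley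
-- of height ≤ −2. Uniqueness holds coefficientwise, because the right-hand side of the system
-- only involves coefficients of lower x-degree. So Den k · F is the unique solution with
-- constant term Den k, and it suffices to exhibit one: at height m ≥ 0, with r = k − m, take
-- x^m Num r, or x^m (Num r + (t − 1) Num (r + 1)) right after an up-step (the next step down
-- leaves a peak), and mirror this to height −1 − m with up and down exchanged. The equations of
-- the system then reduce to Num (r + 2) = (1 + (1 − t) x²) Num (r + 1) − x² Num r.

module Submission where

open import Defs
open import Data.Nat using (ℕ)
open import Relation.Binary.PropositionalEquality using (_≡_)

open import Algebra.Bundles using (CommutativeRing)
open import Algebra.Structures using (IsCommutativeRing)
open import Data.Nat as ℕ using (zero; suc; _∸_; _≤_; _<_; z≤n; s≤s)
import Data.Nat.Properties as ℕP
open import Data.Bool using (Bool; true; false; if_then_else_; _∧_; not)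
open import Data.Integer as ℤ using (ℤ; +_; -[1+_])
import Data.Integer.Properties as ℤP
open import Data.Product using (_,_)
open import Function using (_∘_)
import Relation.Binary.PropositionalEquality as P

module PowerSeries {c ℓ} (R : CommutativeRing c ℓ) where

  open CommutativeRing R
  open import Algebra.Properties.CommutativeSemigroup +-commutativeSemigroup using (interchange)
  open import Relation.Binary.Reasoning.Setoid setoid

  sum≤ : ℕ → (ℕ → Carrier) → Carrier
  sum≤ zero    f = f 0
  sum≤ (suc n) f = sum≤ n f + f (suc n)

  sum≤-cong≤ : ∀ n {f g : ℕ → Carrier} → (∀ a → a ≤ n → f a ≈ g a) → sum≤ n f ≈ sum≤ n g
  sum≤-cong≤ zero    f≈g = f≈g 0 z≤n
  sum≤-cong≤ (suc n) f≈g =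
    +-cong (sum≤-cong≤ n (λ a a≤n → f≈g a (ℕP.m≤n⇒m≤1+n a≤n))) (f≈g (suc n) ℕP.≤-refl)

  sum≤-cong : ∀ n {f g : ℕ → Carrier} → (∀ a → f a ≈ g a) → sum≤ n f ≈ sum≤ n g
  sum≤-cong n f≈g = sum≤-cong≤ n (λ a _ → f≈g a)

  sum≤-distrib-+ : ∀ n (f g : ℕ → Carrier) → sum≤ n (λ a → f a + g a) ≈ sum≤ n f + sum≤ n g
  sum≤-distrib-+ zero    f g = refl
  sum≤-distrib-+ (suc n) f g =
    trans (+-congʳ (sum≤-distrib-+ n f g)) (interchange _ _ _ _)

  *-distribˡ-sum≤ : ∀ n x (f : ℕ → Carrier) → x * sum≤ n f ≈ sum≤ n (λ a → x * f a)
  *-distribˡ-sum≤ zero    x f = refl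
  *-distribˡ-sum≤ (suc n) x f =
    trans (distribˡ x (sum≤ n f) (f (suc n))) (+-congʳ (*-distribˡ-sum≤ n x f))

  *-distribʳ-sum≤ : ∀ n x (f : ℕ → Carrier) → sum≤ n f * x ≈ sum≤ n (λ a → f a * x)
  *-distribʳ-sum≤ n x f =
    trans (*-comm _ _) (trans (*-distribˡ-sum≤ n x f) (sum≤-cong n (λ a → *-comm x (f a))))

  sum≤-unfoldˡ : ∀ n (f : ℕ → Carrier) → sum≤ (suc n) f ≈ f 0 + sum≤ n (λ a → f (suc a))
  sum≤-unfoldˡ zero    f = refl
  sum≤-unfoldˡ (suc n) f = trans (+-congʳ (sum≤-unfoldˡ n f)) (+-assoc _ _ _)

  sum≤-reverse : ∀ n (f : ℕ → Carrier) → sum≤ n f ≈ sum≤ n (λ a → f (n ∸ a))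
  sum≤-reverse zero    f = refl
  sum≤-reverse (suc n) f = begin
    sum≤ n f + f (suc n)                          ≈⟨ +-comm _ _ ⟩
    f (suc n) + sum≤ n f                          ≈⟨ +-congˡ (sum≤-reverse n f) ⟩
    f (suc n) + sum≤ n (λ a → f (n ∸ a))          ≈⟨ sum≤-unfoldˡ n (λ a → f (suc n ∸ a)) ⟨
    sum≤ (suc n) (λ a → f (suc n ∸ a))            ∎

  sum≤-head : ∀ n (f : ℕ → Carrier) → (∀ a → f (suc a) ≈ 0#) → sum≤ n f ≈ f 0
  sum≤-head zero    f f₊≈0 = refl
  sum≤-head (suc n) f f₊≈0 = trans (+-cong (sum≤-head n f f₊≈0) (f₊≈0 n)) (+-identityʳ (f 0))

  sum≤-triangle : ∀ n (F : ℕ → ℕ → Carrier) →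
                  sum≤ n (λ s → sum≤ s (λ a → F a (s ∸ a))) ≈ sum≤ n (λ a → sum≤ (n ∸ a) (F a))
  sum≤-triangle zero    F = refl
  sum≤-triangle (suc n) F = begin
    sum≤ n (λ s → sum≤ s (λ a → F a (s ∸ a))) + (sum≤ n (λ a → F a (suc n ∸ a)) + F (suc n) (suc n ∸ suc n))
      ≈⟨ +-congʳ (sum≤-triangle n F) ⟩
    sum≤ n (λ a → sum≤ (n ∸ a) (F a)) + (sum≤ n (λ a → F a (suc n ∸ a)) + F (suc n) (suc n ∸ suc n))
      ≈⟨ +-assoc _ _ _ ⟨
    (sum≤ n (λ a → sum≤ (n ∸ a) (F a)) + sum≤ n (λ a → F a (suc n ∸ a))) + F (suc n) (n ∸ n)
      ≈⟨ +-cong (sym (sum≤-distrib-+ n _ _)) (reflexive (P.cong (F (suc n)) (ℕP.n∸n≡0 n))) ⟩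
    sum≤ n (λ a → sum≤ (n ∸ a) (F a) + F a (suc n ∸ a)) + F (suc n) 0
      ≈⟨ +-congʳ (sum≤-cong≤ n extendRow) ⟩
    sum≤ n (λ a → sum≤ (suc n ∸ a) (F a)) + sum≤ 0 (F (suc n))
      ≈⟨ +-congˡ (reflexive (P.cong (λ m → sum≤ m (F (suc n))) (P.sym (ℕP.n∸n≡0 (suc n))))) ⟩
    sum≤ n (λ a → sum≤ (suc n ∸ a) (F a)) + sum≤ (suc n ∸ suc n) (F (suc n))
      ∎
    where
    extendRow : ∀ a → a ≤ n → sum≤ (n ∸ a) (F a) + F a (suc n ∸ a) ≈ sum≤ (suc n ∸ a) (F a)
    extendRow a a≤n rewrite ℕP.+-∸-assoc 1 a≤n = refl

  Series : Set c
  Series = ℕ → Carrier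

  infix  4 _≋_
  infixl 6 _⊞_
  infixl 7 _⊠_

  _≋_ : Series → Series → Set ℓ
  f ≋ g = ∀ n → f n ≈ g n

  _⊞_ : Series → Series → Series
  (f ⊞ g) n = f n + g n

  ⊟_ : Series → Series
  (⊟ f) n = - f n

  _⊠_ : Series → Series → Series
  (f ⊠ g) n = sum≤ n (λ a → f a * g (n ∸ a))

  0ₛ : Series
  0ₛ _ = 0#

  const : Carrier → Series
  const a zero    = a
  const a (suc n) = 0#

  𝕩 : Series
  𝕩 zero          = 0#
  𝕩 (suc zero)    = 1#
  𝕩 (suc (suc n)) = 0#

  const-⊠ : ∀ a f → const a ⊠ f ≋ λ n → a * f n
  const-⊠ a f n = sum≤-head n _ (λ b → zeroˡ _)

  𝕩-⊠-zero : ∀ f → (𝕩 ⊠ f) 0 ≈ 0#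
  𝕩-⊠-zero f = zeroˡ (f 0)

  𝕩-⊠-suc : ∀ f n → (𝕩 ⊠ f) (suc n) ≈ f n
  𝕩-⊠-suc f n = begin
    (𝕩 ⊠ f) (suc n)                                  ≈⟨ sum≤-unfoldˡ n _ ⟩
    0# * f (suc n) + sum≤ n (λ a → 𝕩 (suc a) * f (n ∸ a)) ≈⟨ +-cong (zeroˡ _) (sum≤-head n _ (λ a → zeroˡ _)) ⟩
    0# + 1# * f n                                    ≈⟨ +-identityˡ _ ⟩
    1# * f n                                         ≈⟨ *-identityˡ _ ⟩
    f n                                              ∎

  ⊠-comm : ∀ f g → f ⊠ g ≋ g ⊠ f
  ⊠-comm f g n = trans (sum≤-reverse n _) (sum≤-cong≤ n (λ a a≤n →
    trans (*-comm _ _) (*-congʳ (reflexive (P.cong g (ℕP.m∸[m∸n]≡n a≤n))))))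

  ⊠-assoc : ∀ f g h → (f ⊠ g) ⊠ h ≋ f ⊠ (g ⊠ h)
  ⊠-assoc f g h n = begin
    sum≤ n (λ s → sum≤ s (λ a → f a * g (s ∸ a)) * h (n ∸ s))
      ≈⟨ sum≤-cong n (λ s → *-distribʳ-sum≤ s _ _) ⟩
    sum≤ n (λ s → sum≤ s (λ a → f a * g (s ∸ a) * h (n ∸ s)))
      ≈⟨ sum≤-cong n (λ s → sum≤-cong≤ s (λ a a≤s →
           *-congˡ (reflexive (P.cong (λ m → h (n ∸ m)) (P.sym (ℕP.m+[n∸m]≡n a≤s)))))) ⟩
    sum≤ n (λ s → sum≤ s (λ a → F a (s ∸ a)))
      ≈⟨ sum≤-triangle n F ⟩
    sum≤ n (λ a → sum≤ (n ∸ a) (F a))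
      ≈⟨ sum≤-cong n (λ a → sum≤-cong (n ∸ a) (λ b →
           trans (*-assoc _ _ _) (*-congˡ (*-congˡ (reflexive (P.cong h (P.sym (ℕP.∸-+-assoc n a b)))))))) ⟩
    sum≤ n (λ a → sum≤ (n ∸ a) (λ b → f a * (g b * h (n ∸ a ∸ b))))
      ≈⟨ sum≤-cong n (λ a → *-distribˡ-sum≤ (n ∸ a) _ _) ⟨
    sum≤ n (λ a → f a * sum≤ (n ∸ a) (λ b → g b * h (n ∸ a ∸ b)))
      ∎
    where
    F : ℕ → ℕ → Carrier
    F a b = f a * g b * h (n ∸ (a ℕ.+ b))

  ⊠-distribˡ-⊞ : ∀ f g h → f ⊠ (g ⊞ h) ≋ f ⊠ g ⊞ f ⊠ h
  ⊠-distribˡ-⊞ f g h n = trans (sum≤-cong n (λ a → distribˡ _ _ _)) (sum≤-distrib-+ n _ _)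

  ⊠-identityˡ : ∀ f → const 1# ⊠ f ≋ f
  ⊠-identityˡ f n = trans (const-⊠ 1# f n) (*-identityˡ (f n))

  ⊠-cong : ∀ {f f′ g g′} → f ≋ f′ → g ≋ g′ → f ⊠ g ≋ f′ ⊠ g′
  ⊠-cong f≋f′ g≋g′ n = sum≤-cong n (λ a → *-cong (f≋f′ a) (g≋g′ (n ∸ a)))

  series-isCommutativeRing : IsCommutativeRing _≋_ _⊞_ _⊠_ ⊟_ 0ₛ (const 1#)
  series-isCommutativeRing = record
    { isRing = record
      { +-isAbelianGroup = record
        { isGroup = record
          { isMonoid = record
            { isSemigroup = record
              { isMagma = record
                { isEquivalence = record
                  { refl = λ n → refl ; sym = λ e n → sym (e n) ; trans = λ e e′ n → trans (e n) (e′ n) }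
                ; ∙-cong = λ e e′ n → +-cong (e n) (e′ n) }
              ; assoc = λ f g h n → +-assoc (f n) (g n) (h n) }
            ; identity = (λ f n → +-identityˡ (f n)) , (λ f n → +-identityʳ (f n)) }
          ; inverse = (λ f n → -‿inverseˡ (f n)) , (λ f n → -‿inverseʳ (f n))
          ; ⁻¹-cong = λ e n → -‿cong (e n) }
        ; comm = λ f g n → +-comm (f n) (g n) }
      ; *-cong = ⊠-cong
      ; *-assoc = ⊠-assoc
      ; *-identity = ⊠-identityˡ , (λ f n → trans (⊠-comm f (const 1#) n) (⊠-identityˡ f n))
      ; distrib = ⊠-distribˡ-⊞ , (λ f g h n → trans (⊠-comm (g ⊞ h) f n)
                    (trans (⊠-distribˡ-⊞ f g h n) (+-cong (⊠-comm f g n) (⊠-comm f h n))))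
      }
    ; *-comm = ⊠-comm
    }

  seriesRing : CommutativeRing c ℓ
  seriesRing = record { isCommutativeRing = series-isCommutativeRing }

module SeriesRing where

  open import Algebra.Bundles using (RawRing)
  open import Algebra.Morphism.Structures using (IsRingMonomorphism)
  import Algebra.Morphism.RingMonomorphism as RingMonomorphism
  open import Algebra.Solver.Ring.AlmostCommutativeRing
    using (AlmostCommutativeRing; _-Raw-AlmostCommutative⟶_; fromCommutativeRing)
  open import Data.Maybe using (Maybe; just; nothing)
  open import Relation.Nullary using (yes; no)

  module ℤ⟦t⟧ = PowerSeries ℤP.+-*-commutativeRing
  module ℤ⟦t⟧⟦x⟧ = PowerSeries ℤ⟦t⟧.seriesRing

  infix 4 _≈_
  record _≈_ (f g : Ser) : Set where
    constructor mk≈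
    field at : ∀ i j → f i j ≡ g i j
  open _≈_ public

  sumTo≡sum≤ : ∀ n f → sumTo n f ≡ ℤ⟦t⟧.sum≤ n f
  sumTo≡sum≤ zero    f = P.refl
  sumTo≡sum≤ (suc n) f = P.cong (ℤ._+ f (suc n)) (sumTo≡sum≤ n f)

  sum≤-at : ∀ n (F : ℕ → ℕ → ℤ) j → ℤ⟦t⟧⟦x⟧.sum≤ n F j ≡ sumTo n (λ a → F a j)
  sum≤-at zero    F j = P.refl
  sum≤-at (suc n) F j = P.cong (ℤ._+ F (suc n) j) (sum≤-at n F j)

  ⊛≗⊠ : ∀ f g i j → (f ⊛ g) i j ≡ (f ℤ⟦t⟧⟦x⟧.⊠ g) i j
  ⊛≗⊠ f g i j = P.trans (sumTo-cong i (λ a → sumTo≡sum≤ j _)) (P.sym (sum≤-at i _ j))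
    where
    sumTo-cong : ∀ n {f g : ℕ → ℤ} → (∀ a → f a ≡ g a) → sumTo n f ≡ sumTo n g
    sumTo-cong zero    f≡g = f≡g 0
    sumTo-cong (suc n) f≡g = P.cong₂ ℤ._+_ (sumTo-cong n f≡g) (f≡g (suc n))

  𝟙≗1 : ∀ i j → 𝟙 i j ≡ ℤ⟦t⟧⟦x⟧.const (ℤ⟦t⟧.const (+ 1)) i j
  𝟙≗1 zero    zero    = P.refl
  𝟙≗1 zero    (suc j) = P.refl
  𝟙≗1 (suc i) j       = P.refl

  X≗𝕩 : ∀ i j → X i j ≡ ℤ⟦t⟧⟦x⟧.𝕩 i j
  X≗𝕩 zero          j       = P.refl
  X≗𝕩 (suc zero)    zero    = P.refl
  X≗𝕩 (suc zero)    (suc j) = P.refl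
  X≗𝕩 (suc (suc i)) j       = P.refl

  T≗𝕥 : ∀ i j → T i j ≡ ℤ⟦t⟧⟦x⟧.const ℤ⟦t⟧.𝕩 i j
  T≗𝕥 zero    zero          = P.refl
  T≗𝕥 zero    (suc zero)    = P.refl
  T≗𝕥 zero    (suc (suc j)) = P.refl
  T≗𝕥 (suc i) j             = P.refl

  serRawRing : RawRing _ _
  serRawRing = record
    { Carrier = Ser ; _≈_ = _≈_ ; _+_ = _⊕_ ; _*_ = _⊛_ ; -_ = ⊝_ ; 0# = 𝟘 ; 1# = 𝟙 }

  -- Ser is ℤ⟦t⟧⟦x⟧ up to the pointwise equal product and unit of Defs.
  ⊠-isRingMonomorphism : IsRingMonomorphism serRawRing (CommutativeRing.rawRing ℤ⟦t⟧⟦x⟧.seriesRing) (λ f → f)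
  ⊠-isRingMonomorphism = record
    { isRingHomomorphism = record
      { isSemiringHomomorphism = record
        { isNearSemiringHomomorphism = record
          { +-isMonoidHomomorphism = record
            { isMagmaHomomorphism = record
              { isRelHomomorphism = record { cong = at }
              ; homo = λ f g i j → P.refl }
            ; ε-homo = λ i j → P.refl }
          ; *-homo = ⊛≗⊠ }
        ; 1#-homo = 𝟙≗1 }
      ; -‿homo = λ f i j → P.refl }
    ; injective = mk≈
    }

  serRing : CommutativeRing _ _
  serRing = record
    { isCommutativeRing =
        RingMonomorphism.isCommutativeRing ⊠-isRingMonomorphism ℤ⟦t⟧⟦x⟧.series-isCommutativeRing }

  module SerR = CommutativeRing serRing

  ⊕-congˡ : ∀ f {g g′} → g ≈ g′ → f ⊕ g ≈ f ⊕ g′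
  ⊕-congˡ f = SerR.+-cong (SerR.refl {f})

  ⊕-congʳ : ∀ h {f f′} → f ≈ f′ → f ⊕ h ≈ f′ ⊕ h
  ⊕-congʳ h f≈f′ = SerR.+-cong f≈f′ (SerR.refl {h})

  ⊛-congˡ : ∀ f {g g′} → g ≈ g′ → f ⊛ g ≈ f ⊛ g′
  ⊛-congˡ f = SerR.*-cong (SerR.refl {f})

  ⊛-congʳ : ∀ h {f f′} → f ≈ f′ → f ⊛ h ≈ f′ ⊛ h
  ⊛-congʳ h f≈f′ = SerR.*-cong f≈f′ (SerR.refl {h})

  -- Agrees definitionally with 𝟙 = mono 0 0 at z = + 1, so that the solver's constant 1 is 𝟙.
  scalar : ℤ → Ser
  scalar z i j = if (i ℕ.≡ᵇ 0) ∧ (j ℕ.≡ᵇ 0) then z else + 0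

  ⊛-via-⊠ : ∀ {f f′} → (∀ i j → f i j ≡ f′ i j) → ∀ g i j → (f ⊛ g) i j ≡ (f′ ℤ⟦t⟧⟦x⟧.⊠ g) i j
  ⊛-via-⊠ {f} {f′} f≗f′ g i j =
    P.trans (⊛≗⊠ f g i j) (ℤ⟦t⟧⟦x⟧.⊠-cong {f} {f′} {g} {g} f≗f′ (λ _ _ → P.refl) i j)

  scalar-⊛ : ∀ z g i j → (scalar z ⊛ g) i j ≡ z ℤ.* g i j
  scalar-⊛ z g i j = P.trans (⊛-via-⊠ scalar≗const g i j)
    (P.trans (ℤ⟦t⟧⟦x⟧.const-⊠ (ℤ⟦t⟧.const z) g i j) (ℤ⟦t⟧.const-⊠ z (g i) j))
    where
    scalar≗const : ∀ i j → scalar z i j ≡ ℤ⟦t⟧⟦x⟧.const (ℤ⟦t⟧.const z) i j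
    scalar≗const zero    zero    = P.refl
    scalar≗const zero    (suc j) = P.refl
    scalar≗const (suc i) j       = P.refl

  scalar-homo : CommutativeRing.rawRing ℤP.+-*-commutativeRing -Raw-AlmostCommutative⟶ fromCommutativeRing serRing
  scalar-homo = record
    { ⟦_⟧    = scalar
    ; +-homo = λ a b → mk≈ λ { zero zero → P.refl ; zero (suc j) → P.refl ; (suc i) j → P.refl }
    ; *-homo = λ a b → mk≈ λ i j → P.trans (scalar-*-homo a b i j) (P.sym (scalar-⊛ a (scalar b) i j))
    ; -‿homo = λ a → mk≈ λ { zero zero → P.refl ; zero (suc j) → P.refl ; (suc i) j → P.refl }
    ; 0-homo = mk≈ λ { zero zero → P.refl ; zero (suc j) → P.refl ; (suc i) j → P.refl }
    ; 1-homo = SerR.refl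
    }
    where
    scalar-*-homo : ∀ a b i j → scalar (a ℤ.* b) i j ≡ a ℤ.* scalar b i j
    scalar-*-homo a b zero    zero    = P.refl
    scalar-*-homo a b zero    (suc j) = P.sym (ℤP.*-zeroʳ a)
    scalar-*-homo a b (suc i) j       = P.sym (ℤP.*-zeroʳ a)

  scalar-≟ : ∀ a b → Maybe (scalar a ≈ scalar b)
  scalar-≟ a b with a ℤ.≟ b
  ... | yes P.refl = just SerR.refl
  ... | no  _      = nothing

  open import Algebra.Solver.Ring (CommutativeRing.rawRing ℤP.+-*-commutativeRing)
    (fromCommutativeRing serRing) scalar-homo scalar-≟ public
    using (solve; _:=_; _:+_; _:*_; :-_; _:-_; con)

  X-⊛-zero : ∀ g j → (X ⊛ g) 0 j ≡ + 0
  X-⊛-zero g j = P.trans (⊛-via-⊠ X≗𝕩 g 0 j) (ℤ⟦t⟧⟦x⟧.𝕩-⊠-zero g j)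

  X-⊛-suc : ∀ g i j → (X ⊛ g) (suc i) j ≡ g i j
  X-⊛-suc g i j = P.trans (⊛-via-⊠ X≗𝕩 g (suc i) j) (ℤ⟦t⟧⟦x⟧.𝕩-⊠-suc g i j)

  T-⊛-zero : ∀ g i → (T ⊛ g) i 0 ≡ + 0
  T-⊛-zero g i = P.trans (⊛-via-⊠ T≗𝕥 g i 0)
    (P.trans (ℤ⟦t⟧⟦x⟧.const-⊠ ℤ⟦t⟧.𝕩 g i 0) (ℤ⟦t⟧.𝕩-⊠-zero (g i)))

  T-⊛-suc : ∀ g i j → (T ⊛ g) i (suc j) ≡ g i j
  T-⊛-suc g i j = P.trans (⊛-via-⊠ T≗𝕥 g i (suc j))
    (P.trans (ℤ⟦t⟧⟦x⟧.const-⊠ ℤ⟦t⟧.𝕩 g i (suc j)) (ℤ⟦t⟧.𝕩-⊠-suc (g i) j))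

module NumeratorDenominator where

  open SeriesRing
  open import Relation.Binary.Reasoning.Setoid SerR.setoid

  fibX fibS : Ser
  fibX = 𝟙 ⊕ (𝟙 ⊖ T) ⊛ X ⊛ X
  fibS = ⊝ (X ⊛ X)

  Num-zero : Num 0 ≈ 𝟙
  Num-zero = mk≈ λ { zero zero → P.refl ; zero (suc j) → P.refl ; (suc i) zero → P.refl ; (suc i) (suc j) → P.refl }

  Num-one : Num 1 ≈ 𝟙
  Num-one = begin
    𝟙 ⊕ ⊝ (X ⊛ X ⊛ 𝟘) ≈⟨ ⊕-congˡ 𝟙 (SerR.-‿cong (SerR.zeroʳ (X ⊛ X))) ⟩
    𝟙 ⊕ ⊝ 𝟘           ≈⟨ SerR.+-identityʳ 𝟙 ⟩
    𝟙                 ∎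

  Num-rec : ∀ r → Num (suc (suc r)) ≈ fibX ⊛ Num (suc r) ⊕ fibS ⊛ Num r
  Num-rec zero = begin
    (fibX ⊛ 𝟙 ⊕ fibS ⊛ 𝟘) ⊖ X ⊛ X ⊛ 𝟙
      ≈⟨ ⊕-congʳ (⊝ (X ⊛ X ⊛ 𝟙)) (SerR.trans (⊕-congˡ (fibX ⊛ 𝟙) (SerR.zeroʳ fibS)) (SerR.+-identityʳ (fibX ⊛ 𝟙))) ⟩
    fibX ⊛ 𝟙 ⊖ X ⊛ X ⊛ 𝟙
      ≈⟨ solve 2 (λ a x → a :* con (+ 1) :- x :* x :* con (+ 1) := a :* con (+ 1) :+ (:- (x :* x)) :* con (+ 1))
                 SerR.refl fibX X ⟩
    fibX ⊛ 𝟙 ⊕ fibS ⊛ 𝟙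
      ≈⟨ SerR.+-cong (⊛-congˡ fibX Num-one) (⊛-congˡ fibS Num-zero) ⟨
    fibX ⊛ Num 1 ⊕ fibS ⊛ Num 0
      ∎
  Num-rec (suc r) =
    solve 4 (λ φ₁ φ₀ a x →
               let s = :- (x :* x) ; φ₂ = a :* φ₁ :+ s :* φ₀ in
               (a :* φ₂ :+ s :* φ₁) :- x :* x :* φ₂
               := a :* (φ₂ :- x :* x :* φ₁) :+ s :* (φ₁ :- x :* x :* φ₀))
            SerR.refl (Φ (suc r)) (Φ r) fibX X

  Den≈ : ∀ k → Den k ≈ Num (suc k) ⊖ X ⊛ Num k
  Den≈ k = solve 4 (λ φ₁ φ₀ q x → (φ₁ :- x :* (x :+ con (+ 1)) :* φ₀) :+ x :* q
                                   := (φ₁ :- x :* x :* φ₀) :- x :* (φ₀ :- q))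
                   SerR.refl (Φ (suc k)) (Φ k) (x²Φpred k) X

  -- shiftedNum r = Num (r − 1); the value 1 − t at r = 0 is the one forced by the recurrence.
  shiftedNum : ℕ → Ser
  shiftedNum zero    = 𝟙 ⊖ T
  shiftedNum (suc r) = Num r

  shiftedNum-rec : ∀ r → shiftedNum (suc (suc r)) ≈ fibX ⊛ shiftedNum (suc r) ⊕ fibS ⊛ shiftedNum r
  shiftedNum-rec zero = begin
    Num 1                          ≈⟨ Num-one ⟩
    𝟙                              ≈⟨ solve 2 (λ x t → let one = con (+ 1) in
                                                one := (one :+ (one :- t) :* x :* x) :* one :+ (:- (x :* x)) :* (one :- t))
                                              SerR.refl X T ⟩
    fibX ⊛ 𝟙 ⊕ fibS ⊛ (𝟙 ⊖ T)      ≈⟨ ⊕-congʳ (fibS ⊛ (𝟙 ⊖ T)) (⊛-congˡ fibX Num-zero) ⟨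
    fibX ⊛ Num 0 ⊕ fibS ⊛ (𝟙 ⊖ T)  ∎
  shiftedNum-rec (suc r) = Num-rec r

  withPeak : Ser → Ser → Ser
  withPeak a b = a ⊕ (T ⊖ 𝟙) ⊛ b

  peak : ℕ → Ser
  peak s = withPeak (shiftedNum s) (shiftedNum (suc s))

  peak-zero : peak 0 ≈ 𝟘
  peak-zero = begin
    (𝟙 ⊖ T) ⊕ (T ⊖ 𝟙) ⊛ Num 0 ≈⟨ ⊕-congˡ (𝟙 ⊖ T) (⊛-congˡ (T ⊖ 𝟙) Num-zero) ⟩
    (𝟙 ⊖ T) ⊕ (T ⊖ 𝟙) ⊛ 𝟙     ≈⟨ solve 1 (λ t → let one = con (+ 1) in
                                            (one :- t) :+ (t :- one) :* one := t :- t) SerR.refl T ⟩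
    T ⊖ T                     ≈⟨ SerR.-‿inverseʳ T ⟩
    𝟘                         ∎

  module _ (a₀ a₁ : Ser) {a₂ : Ser} (rec : a₂ ≈ fibX ⊛ a₁ ⊕ fibS ⊛ a₀) where

    profile-base : a₁ ≈ (a₂ ⊖ X ⊛ a₁) ⊕ (X ⊛ ((X ⊛ 𝟙) ⊛ withPeak a₀ a₁) ⊕ X ⊛ a₁)
    profile-base = begin
      a₁
        ≈⟨ solve 4 (λ x t b₀ b₁ → let one = con (+ 1) in
                       b₁ := (((one :+ (one :- t) :* x :* x) :* b₁ :+ (:- (x :* x)) :* b₀) :- x :* b₁)
                             :+ (x :* ((x :* one) :* (b₀ :+ (t :- one) :* b₁)) :+ x :* b₁))
                   SerR.refl X T a₀ a₁ ⟩
      ((fibX ⊛ a₁ ⊕ fibS ⊛ a₀) ⊖ X ⊛ a₁) ⊕ (X ⊛ ((X ⊛ 𝟙) ⊛ withPeak a₀ a₁) ⊕ X ⊛ a₁)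
        ≈⟨ ⊕-congʳ (X ⊛ ((X ⊛ 𝟙) ⊛ withPeak a₀ a₁) ⊕ X ⊛ a₁) (⊕-congʳ (⊝ (X ⊛ a₁)) rec) ⟨
      (a₂ ⊖ X ⊛ a₁) ⊕ (X ⊛ ((X ⊛ 𝟙) ⊛ withPeak a₀ a₁) ⊕ X ⊛ a₁)
        ∎

    profile-down : ∀ y → (X ⊛ y) ⊛ a₁ ≈ X ⊛ ((X ⊛ (X ⊛ y)) ⊛ withPeak a₀ a₁) ⊕ X ⊛ (y ⊛ a₂)
    profile-down y = begin
      (X ⊛ y) ⊛ a₁
        ≈⟨ solve 5 (λ x t y b₀ b₁ → let one = con (+ 1) in
                       (x :* y) :* b₁
                       := x :* ((x :* (x :* y)) :* (b₀ :+ (t :- one) :* b₁))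
                          :+ x :* (y :* ((one :+ (one :- t) :* x :* x) :* b₁ :+ (:- (x :* x)) :* b₀)))
                   SerR.refl X T y a₀ a₁ ⟩
      X ⊛ ((X ⊛ (X ⊛ y)) ⊛ withPeak a₀ a₁) ⊕ X ⊛ (y ⊛ (fibX ⊛ a₁ ⊕ fibS ⊛ a₀))
        ≈⟨ ⊕-congˡ (X ⊛ ((X ⊛ (X ⊛ y)) ⊛ withPeak a₀ a₁)) (⊛-congˡ X (⊛-congˡ y rec)) ⟨
      X ⊛ ((X ⊛ (X ⊛ y)) ⊛ withPeak a₀ a₁) ⊕ X ⊛ (y ⊛ a₂)
        ∎

    profile-up : ∀ y → (X ⊛ y) ⊛ withPeak a₁ a₂
                       ≈ X ⊛ ((X ⊛ (X ⊛ y)) ⊛ withPeak a₀ a₁) ⊕ T ⊛ (X ⊛ (y ⊛ a₂))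
    profile-up y = begin
      (X ⊛ y) ⊛ withPeak a₁ a₂
        ≈⟨ ⊛-congˡ (X ⊛ y) (⊕-congˡ a₁ (⊛-congˡ (T ⊖ 𝟙) rec)) ⟩
      (X ⊛ y) ⊛ withPeak a₁ (fibX ⊛ a₁ ⊕ fibS ⊛ a₀)
        ≈⟨ solve 5 (λ x t y b₀ b₁ →
                       let one = con (+ 1)
                           b₂  = (one :+ (one :- t) :* x :* x) :* b₁ :+ (:- (x :* x)) :* b₀
                       in (x :* y) :* (b₁ :+ (t :- one) :* b₂)
                       := x :* ((x :* (x :* y)) :* (b₀ :+ (t :- one) :* b₁)) :+ t :* (x :* (y :* b₂)))
                   SerR.refl X T y a₀ a₁ ⟩
      X ⊛ ((X ⊛ (X ⊛ y)) ⊛ withPeak a₀ a₁) ⊕ T ⊛ (X ⊛ (y ⊛ (fibX ⊛ a₁ ⊕ fibS ⊛ a₀)))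
        ≈⟨ ⊕-congˡ (X ⊛ ((X ⊛ (X ⊛ y)) ⊛ withPeak a₀ a₁)) (⊛-congˡ T (⊛-congˡ X (⊛-congˡ y rec))) ⟨
      X ⊛ ((X ⊛ (X ⊛ y)) ⊛ withPeak a₀ a₁) ⊕ T ⊛ (X ⊛ (y ⊛ a₂))
        ∎

module Counting where

  open import Data.Bool.Properties using (T?)
  open import Data.List using (List; []; _∷_; _++_; map; length; filterᵇ)
  open import Data.List.Properties using (filter-++; length-++)
  open import Data.Vec using (_∷_)

  count : ∀ {A : Set} → (A → Bool) → List A → ℕ
  count p xs = length (filterᵇ p xs)

  count-++ : ∀ {A : Set} (p : A → Bool) xs ys → count p (xs ++ ys) ≡ count p xs ℕ.+ count p ys
  count-++ p xs ys = P.trans (P.cong length (filter-++ (T? ∘ p) xs ys)) (length-++ (filterᵇ p xs))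

  count-map : ∀ {A B : Set} (p : B → Bool) (f : A → B) xs → count p (map f xs) ≡ count (p ∘ f) xs
  count-map p f []       = P.refl
  count-map p f (x ∷ xs) with p (f x)
  ... | true  = P.cong suc (count-map p f xs)
  ... | false = count-map p f xs

  count-cong : ∀ {A : Set} {p q : A → Bool} xs → (∀ x → p x ≡ q x) → count p xs ≡ count q xs
  count-cong {p = p} {q} []       p≗q = P.refl
  count-cong {p = p} {q} (x ∷ xs) p≗q with p x | q x | p≗q x
  ... | true  | .true  | P.refl = P.cong suc (count-cong xs p≗q)
  ... | false | .false | P.refl = count-cong xs p≗q

  count-singleton : ∀ {A : Set} (p : A → Bool) x → count p (x ∷ []) ≡ (if p x then 1 else 0)
  count-singleton p x with p x
  ... | true  = P.refl
  ... | false = P.refl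

  count-none : ∀ {A : Set} {p : A → Bool} xs → (∀ x → p x ≡ false) → count p xs ≡ 0
  count-none {p = p} []       p≗false = P.refl
  count-none {p = p} (x ∷ xs) p≗false with p x | p≗false x
  ... | false | P.refl = count-none xs p≗false

  count-allPaths-suc : ∀ (p : ∀ {m} → Path m → Bool) n →
    count p (allPaths (suc n))
    ≡ count (λ v → p (true ∷ v)) (allPaths n) ℕ.+ count (λ v → p (false ∷ v)) (allPaths n)
  count-allPaths-suc p n =
    P.trans (count-++ p (map (true ∷_) (allPaths n)) (map (false ∷_) (allPaths n)))
            (P.cong₂ ℕ._+_ (count-map p (true ∷_) (allPaths n)) (count-map p (false ∷_) (allPaths n)))

module ExtremalPoints where

  open import Data.Integer using (-_; _≤ᵇ_)
  open import Data.Vec using ([]; _∷_)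

  -- Whether the vertex at height h, entered by a d-step and left by a b-step, is extremal.
  extremal : ℤ → Bool → Bool → Bool
  extremal h true  false = + 1 ≤ᵇ h
  extremal h false true  = h ≤ᵇ - (+ 2)
  extremal h true  true  = false
  extremal h false false = false

  -- The extremal points of a path from height h entered by a d-step, its first vertex included.
  extFrom : ∀ {n} → ℤ → Bool → Path n → ℕ
  extFrom h d []       = 0
  extFrom h d (b ∷ bs) = (if extremal h d b then 1 else 0) ℕ.+ ext h (b ∷ bs)

  e≡extFrom : ∀ {n} (v : Path n) → e v ≡ extFrom (+ 0) true v
  e≡extFrom []          = P.refl
  e≡extFrom (true  ∷ v) = P.refl
  e≡extFrom (false ∷ v) = P.refl

  ext-∷ : ∀ {n} h b (bs : Path n) → ext h (b ∷ bs) ≡ extFrom (step b h) b bs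
  ext-∷ h b     []           = P.refl
  ext-∷ h true  (true  ∷ bs) = P.refl
  ext-∷ h true  (false ∷ bs) = P.refl
  ext-∷ h false (true  ∷ bs) = P.refl
  ext-∷ h false (false ∷ bs) = P.refl

module FirstStepSystem (L H : ℤ) where

  open SeriesRing
  open Counting
  open ExtremalPoints
  open import Data.Bool.Properties using (∧-zeroʳ)
  open import Data.Vec using ([]; _∷_)

  xStep : Bool → Ser → Ser
  xStep false G = X ⊛ G
  xStep true  G = T ⊛ (X ⊛ G)

  -- The first-step equations of the path generating functions, with their constant term 1
  -- (the empty path at heights 0 and −1) replaced by c.
  firstStep : (ℤ → Bool → Ser) → Ser → ℤ → Bool → Ser
  firstStep F c h d =
    if inRange L H h
    then (if isZeroOrMinusOne h then c else 𝟘)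
         ⊕ (xStep (extremal h d true) (F (step true h) true) ⊕ xStep (extremal h d false) (F (step false h) false))
    else 𝟘

  xStep-cong : ∀ w {G G′} → G ≈ G′ → xStep w G ≈ xStep w G′
  xStep-cong false G≈G′ = ⊛-congˡ X G≈G′
  xStep-cong true  G≈G′ = ⊛-congˡ T (⊛-congˡ X G≈G′)

  Solves : Ser → (ℤ → Bool → Ser) → Set
  Solves c F = ∀ h d → F h d ≈ firstStep F c h d

  shiftT : Bool → (ℕ → ℤ) → ℕ → ℤ
  shiftT false f j       = f j
  shiftT true  f zero    = + 0
  shiftT true  f (suc j) = f j

  shiftedCoeff : Bool → Ser → ℕ → ℕ → ℤ
  shiftedCoeff w G zero    j = + 0
  shiftedCoeff w G (suc n) j = shiftT w (G n) j

  xStep-coeff : ∀ w G n j → xStep w G n j ≡ shiftedCoeff w G n j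
  xStep-coeff false G zero    j       = X-⊛-zero G j
  xStep-coeff false G (suc n) j       = X-⊛-suc G n j
  xStep-coeff true  G zero    zero    = T-⊛-zero (X ⊛ G) 0
  xStep-coeff true  G (suc n) zero    = T-⊛-zero (X ⊛ G) (suc n)
  xStep-coeff true  G zero    (suc j) = P.trans (T-⊛-suc (X ⊛ G) 0 j) (X-⊛-zero G j)
  xStep-coeff true  G (suc n) (suc j) = P.trans (T-⊛-suc (X ⊛ G) (suc n) j) (X-⊛-suc G n j)

  firstStepCoeff : Bool → Bool → ℤ → ℤ → ℤ
  firstStepCoeff inStrip atEnd e s = if inStrip then (if atEnd then e else + 0) ℤ.+ s else + 0

  firstStep-coeff : ∀ F c h d n j → firstStep F c h d n j ≡
    firstStepCoeff (inRange L H h) (isZeroOrMinusOne h) (c n j)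
      (shiftedCoeff (extremal h d true) (F (step true h) true) n j
       ℤ.+ shiftedCoeff (extremal h d false) (F (step false h) false) n j)
  firstStep-coeff F c h d n j with inRange L H h | isZeroOrMinusOne h
  ... | false | _     = P.refl
  ... | true  | true  = P.cong (λ s → c n j ℤ.+ s) (P.cong₂ ℤ._+_ (xStep-coeff _ _ n j) (xStep-coeff _ _ n j))
  ... | true  | false = P.cong (λ s → + 0 ℤ.+ s) (P.cong₂ ℤ._+_ (xStep-coeff _ _ n j) (xStep-coeff _ _ n j))

  shiftT-cong : ∀ w {f g : ℕ → ℤ} → (∀ j → f j ≡ g j) → ∀ j → shiftT w f j ≡ shiftT w g j
  shiftT-cong false f≗g j       = f≗g j
  shiftT-cong true  f≗g zero    = P.refl
  shiftT-cong true  f≗g (suc j) = f≗g j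

  -- Coefficients of degree n on the right only involve coefficients of degree n − 1 on the left.
  solution-unique : ∀ {c c′ F G} → c ≈ c′ → Solves c F → Solves c′ G → ∀ n h d j → F h d n j ≡ G h d n j
  solution-unique {c} {c′} {F} {G} c≈c′ F-solves G-solves n h d j =
    P.trans (at (F-solves h d) n j)
    (P.trans (firstStep-coeff F c h d n j)
    (P.trans (P.cong₂ (firstStepCoeff (inRange L H h) (isZeroOrMinusOne h)) (at c≈c′ n j)
                      (P.cong₂ ℤ._+_ (below n) (below n)))
    (P.sym (P.trans (at (G-solves h d) n j) (firstStep-coeff G c′ h d n j)))))
    where
    below : ∀ n {w h′ d′} → shiftedCoeff w (F h′ d′) n j ≡ shiftedCoeff w (G h′ d′) n j
    below zero                  = P.refl
    below (suc n) {w} {h′} {d′} =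
      shiftT-cong w (solution-unique c≈c′ F-solves G-solves n h′ d′) j

  ⊛-xStep : ∀ D w G → D ⊛ xStep w G ≈ xStep w (D ⊛ G)
  ⊛-xStep D false G = solve 3 (λ d x g → d :* (x :* g) := x :* (d :* g)) SerR.refl D X G
  ⊛-xStep D true  G = solve 4 (λ d t x g → d :* (t :* (x :* g)) := t :* (x :* (d :* g))) SerR.refl D T X G

  ⊛-solves : ∀ D {c F} → Solves c F → Solves (D ⊛ c) (λ h d → D ⊛ F h d)
  ⊛-solves D {c} {F} F-solves h d = SerR.trans (⊛-congˡ D (F-solves h d)) ⊛-firstStep
    where
    DF : ℤ → Bool → Ser
    DF h d = D ⊛ F h d
    wᵘ wᵈ : Bool
    wᵘ = extremal h d true
    wᵈ = extremal h d false
    Fᵘ Fᵈ : Ser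
    Fᵘ = F (step true h) true
    Fᵈ = F (step false h) false
    ⊛-steps : D ⊛ (xStep wᵘ Fᵘ ⊕ xStep wᵈ Fᵈ) ≈ xStep wᵘ (D ⊛ Fᵘ) ⊕ xStep wᵈ (D ⊛ Fᵈ)
    ⊛-steps = SerR.trans (SerR.distribˡ D (xStep wᵘ Fᵘ) (xStep wᵈ Fᵈ))
                         (SerR.+-cong (⊛-xStep D wᵘ Fᵘ) (⊛-xStep D wᵈ Fᵈ))
    ⊛-firstStep : D ⊛ firstStep F c h d ≈ firstStep DF (D ⊛ c) h d
    ⊛-firstStep with inRange L H h | isZeroOrMinusOne h
    ... | false | _     = SerR.zeroʳ D
    ... | true  | true  =
      SerR.trans (SerR.distribˡ D c (xStep wᵘ Fᵘ ⊕ xStep wᵈ Fᵈ)) (⊕-congˡ (D ⊛ c) ⊛-steps)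
    ... | true  | false =
      SerR.trans (SerR.distribˡ D 𝟘 (xStep wᵘ Fᵘ ⊕ xStep wᵈ Fᵈ)) (SerR.+-cong (SerR.zeroʳ D) ⊛-steps)

  valid : ∀ {n} → ℤ → Path n → Bool
  valid h v = staysIn L H h v ∧ isZeroOrMinusOne (endHeight h v)

  pathSeries : ℤ → Bool → Ser
  pathSeries h d n j = + count (λ v → valid h v ∧ (extFrom h d v ℕ.≡ᵇ j)) (allPaths n)

  count-shiftT : ∀ {A : Set} w (p : A → Bool) (e : A → ℕ) xs j →
    + count (λ v → p v ∧ (((if w then 1 else 0) ℕ.+ e v) ℕ.≡ᵇ j)) xs
    ≡ shiftT w (λ j → + count (λ v → p v ∧ (e v ℕ.≡ᵇ j)) xs) j
  count-shiftT false p e xs j       = P.refl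
  count-shiftT true  p e xs zero    = P.cong +_ (count-none xs (λ v → ∧-zeroʳ (p v)))
  count-shiftT true  p e xs (suc j) = P.refl

  valid-∷ : ∀ {n} h d b (v : Path n) j →
    (valid h (b ∷ v) ∧ (extFrom h d (b ∷ v) ℕ.≡ᵇ j))
    ≡ inRange L H h ∧ (valid (step b h) v ∧ (((if extremal h d b then 1 else 0) ℕ.+ extFrom (step b h) b v) ℕ.≡ᵇ j))
  valid-∷ h d b v j rewrite ext-∷ h b v with inRange L H h
  ... | true  = P.refl
  ... | false = P.refl

  count-first-step : ∀ h d b n j →
    + count (λ v → valid h (b ∷ v) ∧ (extFrom h d (b ∷ v) ℕ.≡ᵇ j)) (allPaths n)
    ≡ (if inRange L H h then shiftT (extremal h d b) (pathSeries (step b h) b n) j else + 0)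
  count-first-step h d b n j =
    P.trans (P.cong +_ (count-cong (allPaths n) (λ v → valid-∷ h d b v j))) (byStrip (inRange L H h))
    where
    byStrip : ∀ r → + count (λ v → r ∧ (valid (step b h) v
                                        ∧ (((if extremal h d b then 1 else 0) ℕ.+ extFrom (step b h) b v) ℕ.≡ᵇ j)))
                             (allPaths n)
                    ≡ (if r then shiftT (extremal h d b) (pathSeries (step b h) b n) j else + 0)
    byStrip false = P.cong +_ (count-none (allPaths n) (λ _ → P.refl))
    byStrip true  = count-shiftT (extremal h d b) (valid (step b h)) (extFrom (step b h) b) (allPaths n) j

  pathSeries-solves : Solves 𝟙 pathSeries
  pathSeries-solves h d = mk≈ λ n j → P.trans (coeff n j) (P.sym (firstStep-coeff pathSeries 𝟙 h d n j))
    where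
    shifted : Bool → ℕ → ℕ → ℤ
    shifted b n = shiftT (extremal h d b) (pathSeries (step b h) b n)

    atEnd : ∀ r z j → + (if (r ∧ z) ∧ (0 ℕ.≡ᵇ j) then 1 else 0) ≡ firstStepCoeff r z (𝟙 0 j) (+ 0 ℤ.+ + 0)
    atEnd false z     j       = P.refl
    atEnd true  true  zero    = P.refl
    atEnd true  true  (suc j) = P.refl
    atEnd true  false zero    = P.refl
    atEnd true  false (suc j) = P.refl

    inStrip : ∀ r z (u v : ℤ) → (if r then u else + 0) ℤ.+ (if r then v else + 0)
                                ≡ firstStepCoeff r z (+ 0) (u ℤ.+ v)
    inStrip false z     u v = P.refl
    inStrip true  true  u v = P.sym (ℤP.+-identityˡ (u ℤ.+ v))
    inStrip true  false u v = P.sym (ℤP.+-identityˡ (u ℤ.+ v))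

    coeff : ∀ n j → pathSeries h d n j
                    ≡ firstStepCoeff (inRange L H h) (isZeroOrMinusOne h) (𝟙 n j)
                        (shiftedCoeff (extremal h d true) (pathSeries (step true h) true) n j
                         ℤ.+ shiftedCoeff (extremal h d false) (pathSeries (step false h) false) n j)
    coeff zero    j = P.trans (P.cong +_ (count-singleton (λ v → valid h v ∧ (extFrom h d v ℕ.≡ᵇ j)) []))
                              (atEnd (inRange L H h) (isZeroOrMinusOne h) j)
    coeff (suc n) j = P.trans (P.cong +_ (count-allPaths-suc (λ v → valid h v ∧ (extFrom h d v ℕ.≡ᵇ j)) n))
                        (P.trans (P.cong₂ ℤ._+_ (count-first-step h d true n j) (count-first-step h d false n j))
                                 (inStrip (inRange L H h) (isZeroOrMinusOne h) (shifted true n j) (shifted false n j)))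

module Arithmetic where

  open import Data.Bool.Properties using (T-≡)
  open import Data.Empty using (⊥-elim)
  open import Function using (Equivalence)
  open import Relation.Nullary using (¬_)

  ≤⇒≤ᵇ≡true : ∀ {m n} → m ≤ n → (m ℕ.≤ᵇ n) ≡ true
  ≤⇒≤ᵇ≡true m≤n = Equivalence.to T-≡ (ℕP.≤⇒≤ᵇ m≤n)

  ≤ᵇ≡true⇒≤ : ∀ {m n} → (m ℕ.≤ᵇ n) ≡ true → m ≤ n
  ≤ᵇ≡true⇒≤ {m} {n} m≤ᵇn = ℕP.≤ᵇ⇒≤ m n (Equivalence.from T-≡ m≤ᵇn)

  ≰⇒≤ᵇ≡false : ∀ {m n} → ¬ m ≤ n → (m ℕ.≤ᵇ n) ≡ false
  ≰⇒≤ᵇ≡false {m} {n} m≰n with m ℕ.≤ᵇ n in m≤ᵇn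
  ... | true  = ⊥-elim (m≰n (≤ᵇ≡true⇒≤ m≤ᵇn))
  ... | false = P.refl

  ∸≡suc∸suc : ∀ {m n} → m < n → n ∸ m ≡ suc (n ∸ suc m)
  ∸≡suc∸suc {zero}  {suc n} _         = P.refl
  ∸≡suc∸suc {suc m} {suc n} (s≤s m<n) = ∸≡suc∸suc m<n

module ExplicitSolution (k : ℕ) where

  open SeriesRing
  open NumeratorDenominator
  open ExtremalPoints using (extremal)
  open FirstStepSystem -[1+ k ] (+ k)
  open Arithmetic
  open import Data.Sum using (inj₁; inj₂)
  open import Relation.Nullary using (yes; no)
  open import Relation.Binary.Reasoning.Setoid SerR.setoid

  X^ : ℕ → Ser
  X^ zero    = 𝟙
  X^ (suc m) = X ⊛ X^ m

  -- The value at height m ≥ 0 of Den k times the path generating functions, r = k − m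
  -- being the distance to the top of the strip.
  profile : ℕ → ℕ → Bool → Ser
  profile zero    r d     = Num r
  profile (suc m) r false = X^ (suc m) ⊛ Num r
  profile (suc m) r true  = X^ (suc m) ⊛ peak (suc r)

  solution⁺ : ℕ → Bool → Ser
  solution⁺ m d = if m ℕ.≤ᵇ k then profile m (k ∸ m) d else 𝟘

  solution : ℤ → Bool → Ser
  solution (+ m)    d = solution⁺ m d
  solution -[1+ m ] d = solution⁺ m (not d)

  solution⁺-down : ∀ m → m ≤ k → solution⁺ m false ≈ X^ m ⊛ Num (k ∸ m)
  solution⁺-down zero    _   = SerR.sym (SerR.*-identityˡ (Num k))
  solution⁺-down (suc m) m<k rewrite ≤⇒≤ᵇ≡true m<k = SerR.refl

  solution⁺-up : ∀ m → m ≤ k → solution⁺ (suc m) true ≈ X^ (suc m) ⊛ peak (k ∸ m)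
  solution⁺-up m m≤k with ℕP.m≤n⇒m<n∨m≡n m≤k
  ... | inj₁ m<k    rewrite ≤⇒≤ᵇ≡true m<k | ∸≡suc∸suc m<k = SerR.refl
  ... | inj₂ P.refl rewrite ≰⇒≤ᵇ≡false (ℕP.<-irrefl (P.refl {x = m})) | ℕP.n∸n≡0 m =
    SerR.sym (SerR.trans (⊛-congˡ (X^ (suc m)) peak-zero) (SerR.zeroʳ (X^ (suc m))))

  endTerm : ℕ → Ser
  endTerm zero    = Den k
  endTerm (suc m) = 𝟘

  downTerm : ℕ → Bool → Ser
  downTerm zero    d = X ⊛ solution⁺ 0 true
  downTerm (suc m) d = xStep d (solution⁺ m false)

  solution⁺-eq : ∀ m d → m ≤ k → solution⁺ m d ≈ endTerm m ⊕ (X ⊛ solution⁺ (suc m) true ⊕ downTerm m d)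
  solution⁺-eq zero d _ = begin
    Num k
      ≈⟨ profile-base (shiftedNum k) (Num k) (shiftedNum-rec k) ⟩
    (Num (suc k) ⊖ X ⊛ Num k) ⊕ (X ⊛ ((X ⊛ 𝟙) ⊛ peak k) ⊕ X ⊛ Num k)
      ≈⟨ SerR.+-cong (Den≈ k) (⊕-congʳ (X ⊛ Num k) (⊛-congˡ X (solution⁺-up 0 z≤n))) ⟨
    Den k ⊕ (X ⊛ solution⁺ 1 true ⊕ X ⊛ Num k)
      ∎
  solution⁺-eq (suc m) d 1+m≤k rewrite ≤⇒≤ᵇ≡true 1+m≤k = begin
    profile (suc m) r d
      ≈⟨ profile-step d ⟩
    X ⊛ ((X ⊛ (X ⊛ X^ m)) ⊛ peak r) ⊕ xStep d (X^ m ⊛ Num (suc r))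
      ≈⟨ SerR.+-cong (⊛-congˡ X (solution⁺-up (suc m) 1+m≤k)) (xStep-cong d lower) ⟨
    X ⊛ solution⁺ (suc (suc m)) true ⊕ xStep d (solution⁺ m false)
      ≈⟨ SerR.+-identityˡ _ ⟨
    𝟘 ⊕ (X ⊛ solution⁺ (suc (suc m)) true ⊕ xStep d (solution⁺ m false))
      ∎
    where
    r : ℕ
    r = k ∸ suc m
    profile-step : ∀ d → profile (suc m) r d ≈ X ⊛ ((X ⊛ (X ⊛ X^ m)) ⊛ peak r) ⊕ xStep d (X^ m ⊛ Num (suc r))
    profile-step false = profile-down (shiftedNum r) (Num r) (shiftedNum-rec r) (X^ m)
    profile-step true  = profile-up (shiftedNum r) (Num r) (shiftedNum-rec r) (X^ m)
    lower : solution⁺ m false ≈ X^ m ⊛ Num (suc r)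
    lower = SerR.trans (solution⁺-down m (ℕP.<⇒≤ 1+m≤k))
                       (SerR.reflexive (P.cong (λ s → X^ m ⊛ Num s) (∸≡suc∸suc 1+m≤k)))

  firstStep-nonneg : ∀ m d → (m ℕ.≤ᵇ k) ≡ true →
    firstStep solution (Den k) (+ m) d ≡ endTerm m ⊕ (X ⊛ solution⁺ (suc m) true ⊕ downTerm m d)
  firstStep-nonneg m d inStrip rewrite inStrip | ℕP.+-comm m 1 = reduced m d
    where
    reduced : ∀ m d → (if isZeroOrMinusOne (+ m) then Den k else 𝟘)
                        ⊕ (xStep (extremal (+ m) d true) (solution (+ suc m) true)
                           ⊕ xStep (extremal (+ m) d false) (solution (step false (+ m)) false))
                      ≡ endTerm m ⊕ (X ⊛ solution⁺ (suc m) true ⊕ downTerm m d)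
    reduced zero    true  = P.refl
    reduced zero    false = P.refl
    reduced (suc m) true  = P.refl
    reduced (suc m) false = P.refl

  firstStep-neg : ∀ m d → (m ℕ.≤ᵇ k) ≡ true →
    firstStep solution (Den k) -[1+ m ] d ≡ endTerm m ⊕ (downTerm m (not d) ⊕ X ⊛ solution⁺ (suc m) true)
  firstStep-neg m d inStrip rewrite inStrip | ℕP.+-identityʳ m = reduced m d
    where
    reduced : ∀ m d → (if isZeroOrMinusOne -[1+ m ] then Den k else 𝟘)
                        ⊕ (xStep (extremal -[1+ m ] d true) (solution (step true -[1+ m ]) true)
                           ⊕ xStep (extremal -[1+ m ] d false) (solution -[1+ suc m ] false))
                      ≡ endTerm m ⊕ (downTerm m (not d) ⊕ X ⊛ solution⁺ (suc m) true)
    reduced zero    true  = P.refl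
    reduced zero    false = P.refl
    reduced (suc m) true  = P.refl
    reduced (suc m) false = P.refl

  solution-solves : Solves (Den k) solution
  solution-solves (+ m) d with m ℕ.≤? k
  ... | yes m≤k =
    SerR.trans (solution⁺-eq m d m≤k) (SerR.reflexive (P.sym (firstStep-nonneg m d (≤⇒≤ᵇ≡true m≤k))))
  ... | no  m≰k rewrite ≰⇒≤ᵇ≡false m≰k = SerR.refl
  solution-solves -[1+ m ] d with m ℕ.≤? k
  ... | yes m≤k = begin
    solution⁺ m (not d)
      ≈⟨ solution⁺-eq m (not d) m≤k ⟩
    endTerm m ⊕ (X ⊛ solution⁺ (suc m) true ⊕ downTerm m (not d))
      ≈⟨ ⊕-congˡ (endTerm m) (SerR.+-comm (X ⊛ solution⁺ (suc m) true) (downTerm m (not d))) ⟩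
    endTerm m ⊕ (downTerm m (not d) ⊕ X ⊛ solution⁺ (suc m) true)
      ≡⟨ firstStep-neg m d (≤⇒≤ᵇ≡true m≤k) ⟨
    firstStep solution (Den k) -[1+ m ] d
      ∎
  ... | no  m≰k rewrite ≰⇒≤ᵇ≡false m≰k = SerR.refl

module StripBounds where

  open import Data.Nat.DivMod using (_/_; /-congˡ; +-distrib-/-∣ʳ; m*n/n≡m)
  open import Data.Nat.Divisibility using (divides-refl)

  lowBound-odd : ∀ k → lowBound (suc (2 ℕ.* k)) ≡ -[1+ k ]
  lowBound-odd k = P.cong (λ m → ℤ.- (+ m))
    (P.trans (/-congˡ {o = 2} (P.cong (suc ∘ suc) (ℕP.*-comm 2 k))) (m*n/n≡m (suc k) 2))

  highBound-odd : ∀ k → highBound (suc (2 ℕ.* k)) ≡ + k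
  highBound-odd k = P.cong +_ (begin
    suc (2 ℕ.* k) / 2       ≡⟨ /-congˡ {o = 2} (P.cong suc (ℕP.*-comm 2 k)) ⟩
    (1 ℕ.+ k ℕ.* 2) / 2     ≡⟨ +-distrib-/-∣ʳ 1 {d = 2} (divides-refl k) ⟩
    1 / 2 ℕ.+ k ℕ.* 2 / 2   ≡⟨ m*n/n≡m k 2 ⟩
    k                       ∎)
    where open P.≡-Reasoning

open SeriesRing using (_≈_; mk≈; at; module SerR; ⊛-congʳ)

GF≈pathSeries : ∀ k → GF k ≈ FirstStepSystem.pathSeries -[1+ k ] (+ k) (+ 0) true
GF≈pathSeries k = mk≈ λ n j → P.cong +_ (count-cong (allPaths n) (same-predicate j))
  where
  open Counting using (count-cong)
  open ExtremalPoints using (extFrom; e≡extFrom)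
  open StripBounds
  open FirstStepSystem -[1+ k ] (+ k) using (valid)
  same-predicate : ∀ {n} j (v : Path n) →
    (inA (suc (2 ℕ.* k)) v ∧ (e v ℕ.≡ᵇ j)) ≡ (valid (+ 0) v ∧ (extFrom (+ 0) true v ℕ.≡ᵇ j))
  same-predicate j v rewrite lowBound-odd k | highBound-odd k | e≡extFrom v = P.refl

theorem1 : (k : ℕ) → (n j : ℕ) → (GF k ⊛ Den k) n j ≡ Num k n j
theorem1 k n j = begin
  (GF k ⊛ Den k) n j
    ≡⟨ at (⊛-congʳ (Den k) (GF≈pathSeries k)) n j ⟩
  (pathSeries (+ 0) true ⊛ Den k) n j
    ≡⟨ at (SerR.*-comm (pathSeries (+ 0) true) (Den k)) n j ⟩
  (Den k ⊛ pathSeries (+ 0) true) n j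
    ≡⟨ solution-unique (SerR.*-identityʳ (Den k)) (⊛-solves (Den k) pathSeries-solves) solution-solves n (+ 0) true j ⟩
  solution (+ 0) true n j
    ∎
  where
  open P.≡-Reasoning
  open FirstStepSystem -[1+ k ] (+ k) using (pathSeries; pathSeries-solves; ⊛-solves; solution-unique)
  open ExplicitSolution k using (solution; solution-solves)
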